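{- Let $\eta\in(0,1)$ and let $(\Omega_i)_{i\in\mathbb{N}}$ be a sequence of positive numbers with $\Omega_j/\Omega_{j+1}\le\eta/2$ for all $j\in\mathbb{N}$. Let $G$ be a graph of order $n$ with average degree $k$. Then there is an index $i^*\le 4/\eta$ and a spanning subgraph $G'\subseteq G$ with $e(G')\ge e(G)-\eta kn$ such that $G'$ contains no vertex with degree in the interval $[\Omega_{i^*}k,\Omega_{i^*+1}k)$.
   Context: Graphs are finite and simple; $\mathbb{N}=\{1,2,\dots\}$; the average degree of $G$ is $2e(G)/n$.
   Formalization: The parameter η takes rational values in (0,1), and the sequence $(\Omega_i)_{i\in\mathbb{N}}$ has rational terms. -}

module Defs where

open import Data.Bool using (Bool; true; false; if_then_else_; _∧_)
open import Data.Nat using (ℕ; _<ᵇ_)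
open import Data.Fin using (Fin; toℕ)
open import Data.List using (map; allFin)
open import Data.Nat.ListAction using (sum)
open import Relation.Binary.PropositionalEquality using (_≡_)
open import Data.Integer using (+_)
open import Data.Rational using (ℚ; _/_)

record Graph (n : ℕ) : Set where
  field
    adj    : Fin n → Fin n → Bool
    sym    : ∀ u v → adj u v ≡ adj v u
    irrefl : ∀ v → adj v v ≡ false
open Graph public

degree : ∀ {n} → Graph n → Fin n → ℕ
degree {n} G v = sum (map (λ u → if adj G v u then 1 else 0) (allFin n))

edges : ∀ {n} → Graph n → ℕ
edges {n} G = sum (map (λ u → sum (map (λ v →
  if adj G u v ∧ (toℕ u <ᵇ toℕ v) then 1 else 0) (allFin n))) (allFin n))

SpanningSubgraph : ∀ {n} → Graph n → Graph n → Set
SpanningSubgraph {n} G' G = ∀ u v → adj G' u v ≡ true → adj G u v ≡ true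

ℕ→ℚ : ℕ → ℚ
ℕ→ℚ m = + m / 1

-- Fix a window index i and repeatedly strip all edges at a vertex whose current degree lies in
-- the window [Ω_i k, Ω_{i+1} k), charging that degree to the vertex.  The resulting spanning
-- subgraph has no degree in the window and has lost exactly the total charge.  As η ≤ 1 the
-- window bounds at least double, so whenever a vertex is charged in some window, its charges
-- from the earlier windows add up to at most twice the new charge, which is itself at most its
-- degree; hence a vertex v is charged at most 3 deg v over all windows.  Summing over v, the
-- windows 1, …, m cost at most 6 e(G) together; for m ≈ 3/η the cheapest of them costs at most
-- 6 e(G)/m ≤ 2η e(G) = ηkn, and its index is at most m ≤ 4/η.
module Submission where

open import Defs hiding (sym)
open import Data.Nat using (ℕ; suc; NonZero) renaming (_≤_ to _≤ℕ_)
open import Data.Fin using (Fin)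
open import Data.Product using (Σ; _×_; _,_; ∃; proj₁)
open import Relation.Nullary using (¬_; _×-dec_)
open import Data.Sum using (_⊎_; inj₁; inj₂)
open import Function using (_∘_)
open import Relation.Binary.PropositionalEquality
open import Relation.Unary using (Decidable)
import Data.Nat as ℕ
import Data.Nat.Properties as ℕ
open import Algebra.Properties.Semiring.Sum ℕ.+-*-semiring using (sum-syntax; *-distribˡ-sum)

module Counting where

  open import Data.Bool using (Bool; true; false; T; if_then_else_; _∧_; _∨_; not)
  open import Data.Bool.Properties using (∧-zeroʳ; ∧-identityʳ; ∨-comm)
  open import Data.Empty using (⊥)
  open import Data.Fin using (zero; suc; toℕ)
  open import Data.Fin.Properties using (_≟_; toℕ-injective; suc-injective; any?)
  open import Data.List using (map; tabulate; allFin)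
  open import Data.Nat using (zero; suc; _+_; _*_; _≤_; _<_; _<ᵇ_; z≤n; s≤s)
  open import Data.Nat.Induction using (<-wellFounded)
  open import Data.Nat.ListAction using () renaming (sum to sumˡ)
  open import Data.Nat.Properties
    using ( +-identityʳ; +-assoc; +-comm; +-mono-≤; +-monoʳ-≤; *-monoʳ-≤; *-cancelˡ-≡
          ; ≤-refl; ≤-reflexive; <⇒≤; ≰⇒>; _≤?_; m<m+n; m<n⇒m<1+n; n≢0⇒n>0; n≤0⇒n≡0
          ; module ≤-Reasoning)
  open import Data.Nat.Solver using (module +-*-Solver)
  open import Data.Vec.Functional using (updateAt)
  open import Data.Vec.Functional.Properties using (updateAt-updates; updateAt-minimal)
  open import Function using (id; const)
  open import Induction.WellFounded using (Acc; acc)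
  open import Relation.Nullary using (Dec; does; yes; no; contradiction)
  open import Relation.Nullary.Decidable using (dec-true; dec-false)
  open import Algebra.Properties.Semiring.Sum ℕ.+-*-semiring
    using (sum; sum-cong-≗; sum-replicate-zero; ∑-distrib-+; ∑-comm)

  sumˡ-map-tabulate : ∀ {A : Set} {n} (g : Fin n → A) (f : A → ℕ) →
                      sumˡ (map f (tabulate g)) ≡ ∑[ i < n ] f (g i)
  sumˡ-map-tabulate {n = zero}  g f = refl
  sumˡ-map-tabulate {n = suc n} g f = cong (f (g zero) +_) (sumˡ-map-tabulate (g ∘ suc) f)

  ∑-mono-≤ : ∀ {n} {f g : Fin n → ℕ} → (∀ i → f i ≤ g i) → ∑[ i < n ] f i ≤ ∑[ i < n ] g i
  ∑-mono-≤ {zero}  f≤g = z≤n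
  ∑-mono-≤ {suc n} f≤g = +-mono-≤ (f≤g zero) (∑-mono-≤ (f≤g ∘ suc))

  ∑-distrib-+₃ : ∀ {n} (f g h : Fin n → ℕ) →
                 ∑[ i < n ] (f i + g i + h i) ≡ ∑[ i < n ] f i + ∑[ i < n ] g i + ∑[ i < n ] h i
  ∑-distrib-+₃ f g h = trans (∑-distrib-+ (λ i → f i + g i) h) (cong (_+ sum h) (∑-distrib-+ f g))

  ∑-single : ∀ {n} (f : Fin n → ℕ) v → (∀ w → w ≢ v → f w ≡ 0) → ∑[ w < n ] f w ≡ f v
  ∑-single {suc n} f zero f≡0 = begin
    f zero + ∑[ w < n ] f (suc w) ≡⟨ cong (f zero +_) (sum-cong-≗ λ w → f≡0 (suc w) λ ()) ⟩
    f zero + ∑[ w < n ] 0         ≡⟨ cong (f zero +_) (sum-replicate-zero n) ⟩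
    f zero + 0                    ≡⟨ +-identityʳ (f zero) ⟩
    f zero                        ∎
    where open ≡-Reasoning
  ∑-single {suc n} f (suc v) f≡0 =
    cong₂ _+_ (f≡0 zero λ ()) (∑-single (f ∘ suc) v λ w w≢v → f≡0 (suc w) (w≢v ∘ suc-injective))

  ∑-updateAt : ∀ {n} (c : Fin n → ℕ) v (f : ℕ → ℕ) →
               ∑[ u < n ] updateAt c v f u + c v ≡ ∑[ u < n ] c u + f (c v)
  ∑-updateAt {suc n} c zero f =
    solve 3 (λ c₀ s fc₀ → fc₀ :+ s :+ c₀ := c₀ :+ s :+ fc₀) refl
      (c zero) (∑[ u < n ] c (suc u)) (f (c zero))
    where open +-*-Solver
  ∑-updateAt {suc n} c (suc v) f = begin
    c zero + ∑[ u < n ] c′ u + c (suc v)            ≡⟨ +-assoc (c zero) _ (c (suc v)) ⟩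
    c zero + (∑[ u < n ] c′ u + c (suc v))          ≡⟨ cong (c zero +_) (∑-updateAt (c ∘ suc) v f) ⟩
    c zero + (∑[ u < n ] c (suc u) + f (c (suc v))) ≡⟨ +-assoc (c zero) _ (f (c (suc v))) ⟨
    c zero + ∑[ u < n ] c (suc u) + f (c (suc v))   ∎
    where
    open ≡-Reasoning
    c′ = updateAt (c ∘ suc) v f

  𝟙 : Bool → ℕ
  𝟙 b = if b then 1 else 0

  𝟙-mono : ∀ {a b} → (a ≡ true → b ≡ true) → 𝟙 a ≤ 𝟙 b
  𝟙-mono {false} a⇒b = z≤n
  𝟙-mono {true}  a⇒b rewrite a⇒b refl = ≤-refl

  <ᵇ-exclusive : ∀ m n → m ≢ n → 𝟙 (m <ᵇ n) + 𝟙 (n <ᵇ m) ≡ 1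
  <ᵇ-exclusive zero    zero    m≢n = contradiction refl m≢n
  <ᵇ-exclusive zero    (suc n) m≢n = refl
  <ᵇ-exclusive (suc m) zero    m≢n = refl
  <ᵇ-exclusive (suc m) (suc n) m≢n = <ᵇ-exclusive m n (m≢n ∘ cong suc)

  𝟙-orient : ∀ a m n → (T a → m ≢ n) → 𝟙 a ≡ 𝟙 (a ∧ (m <ᵇ n)) + 𝟙 (a ∧ (n <ᵇ m))
  𝟙-orient false m n _   = refl
  𝟙-orient true  m n m≢n = sym (<ᵇ-exclusive m n (m≢n _))

  𝟙-split : ∀ a s t → (T s → T t → T a → ⊥) → 𝟙 a ≡ 𝟙 (a ∧ not (s ∨ t)) + 𝟙 (a ∧ s) + 𝟙 (a ∧ t)
  𝟙-split false s     t     _    = refl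
  𝟙-split true  false false _    = refl
  𝟙-split true  false true  _    = refl
  𝟙-split true  true  false _    = refl
  𝟙-split true  true  true  ¬all = contradiction _ (¬all _ _)

  𝟙-∧-≟-refl : ∀ {n} a (v : Fin n) → 𝟙 (a ∧ does (v ≟ v)) ≡ 𝟙 a
  𝟙-∧-≟-refl a v = trans (cong (𝟙 ∘ (a ∧_)) (dec-true (v ≟ v) refl)) (cong 𝟙 (∧-identityʳ a))

  𝟙-∧-≟-≢ : ∀ {n} a {u v : Fin n} → u ≢ v → 𝟙 (a ∧ does (u ≟ v)) ≡ 0
  𝟙-∧-≟-≢ a {u} {v} u≢v = trans (cong (𝟙 ∘ (a ∧_)) (dec-false (u ≟ v) u≢v)) (cong 𝟙 (∧-zeroʳ a))

  degree-∑ : ∀ {n} (G : Graph n) v → degree G v ≡ ∑[ u < n ] 𝟙 (adj G v u)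
  degree-∑ G v = sumˡ-map-tabulate id (𝟙 ∘ adj G v)

  Ascending : ∀ {n} → Graph n → Fin n → Fin n → ℕ
  Ascending G u w = 𝟙 (adj G u w ∧ (toℕ u <ᵇ toℕ w))

  edges-∑ : ∀ {n} (G : Graph n) → edges G ≡ ∑[ u < n ] ∑[ w < n ] Ascending G u w
  edges-∑ {n} G = trans (sumˡ-map-tabulate id (λ u → sumˡ (map (Ascending G u) (allFin n))))
                        (sum-cong-≗ λ u → sumˡ-map-tabulate id (Ascending G u))

  adj⇒≢ : ∀ {n} (G : Graph n) {u w} → T (adj G u w) → u ≢ w
  adj⇒≢ G {u} uw refl = subst T (irrefl G u) uw

  𝟙-adj-orient : ∀ {n} (G : Graph n) u w → 𝟙 (adj G u w) ≡ Ascending G u w + Ascending G w u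
  𝟙-adj-orient G u w = begin
    𝟙 (adj G u w)
      ≡⟨ 𝟙-orient (adj G u w) (toℕ u) (toℕ w) (λ uw → adj⇒≢ G uw ∘ toℕ-injective) ⟩
    Ascending G u w + 𝟙 (adj G u w ∧ (toℕ w <ᵇ toℕ u))
      ≡⟨ cong (λ b → Ascending G u w + 𝟙 (b ∧ (toℕ w <ᵇ toℕ u))) (Graph.sym G u w) ⟩
    Ascending G u w + Ascending G w u
      ∎
    where open ≡-Reasoning

  handshake : ∀ {n} (G : Graph n) → ∑[ v < n ] degree G v ≡ 2 * edges G
  handshake {n} G = begin
    ∑[ u < n ] degree G u
      ≡⟨ sum-cong-≗ (λ u → trans (degree-∑ G u) (sum-cong-≗ (𝟙-adj-orient G u))) ⟩
    ∑[ u < n ] ∑[ w < n ] (Ascending G u w + Ascending G w u)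
      ≡⟨ sum-cong-≗ (λ u → ∑-distrib-+ (Ascending G u) (λ w → Ascending G w u)) ⟩
    ∑[ u < n ] (∑[ w < n ] Ascending G u w + ∑[ w < n ] Ascending G w u)
      ≡⟨ ∑-distrib-+ (λ u → ∑[ w < n ] Ascending G u w) (λ u → ∑[ w < n ] Ascending G w u) ⟩
    ∑[ u < n ] ∑[ w < n ] Ascending G u w + ∑[ u < n ] ∑[ w < n ] Ascending G w u
      ≡⟨ cong (∑[ u < n ] ∑[ w < n ] Ascending G u w +_) (∑-comm (λ u w → Ascending G w u)) ⟩
    ∑[ u < n ] ∑[ w < n ] Ascending G u w + ∑[ w < n ] ∑[ u < n ] Ascending G w u
      ≡⟨ cong₂ _+_ (edges-∑ G) (edges-∑ G) ⟨
    edges G + edges G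
      ≡⟨ cong (edges G +_) (+-identityʳ (edges G)) ⟨
    2 * edges G
      ∎
    where open ≡-Reasoning

  isolate : ∀ {n} → Graph n → Fin n → Graph n
  isolate G v = record
    { adj    = λ u w → adj G u w ∧ not (does (u ≟ v) ∨ does (w ≟ v))
    ; sym    = λ u w → cong₂ _∧_ (Graph.sym G u w) (cong not (∨-comm (does (u ≟ v)) (does (w ≟ v))))
    ; irrefl = λ u → cong (_∧ _) (irrefl G u)
    }

  isolate-⊆ : ∀ {n} (G : Graph n) v → SpanningSubgraph (isolate G v) G
  isolate-⊆ G v u w = ∧-true-elimˡ
    where
    ∧-true-elimˡ : ∀ {a b} → a ∧ b ≡ true → a ≡ true
    ∧-true-elimˡ {true} _ = refl

  degree-mono : ∀ {n} {H G : Graph n} → SpanningSubgraph H G → ∀ v → degree H v ≤ degree G v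
  degree-mono {H = H} {G} H⊆G v =
    subst₂ _≤_ (sym (degree-∑ H v)) (sym (degree-∑ G v)) (∑-mono-≤ λ u → 𝟙-mono (H⊆G v u))

  degree-isolate-self : ∀ {n} (G : Graph n) v → degree (isolate G v) v ≡ 0
  degree-isolate-self {n} G v = begin
    degree (isolate G v) v                                        ≡⟨ degree-∑ (isolate G v) v ⟩
    ∑[ w < n ] 𝟙 (adj G v w ∧ not (does (v ≟ v) ∨ does (w ≟ v))) ≡⟨ sum-cong-≗ vanish ⟩
    ∑[ w < n ] 0                                                  ≡⟨ sum-replicate-zero n ⟩
    0                                                             ∎
    where
    open ≡-Reasoning
    vanish : ∀ w → 𝟙 (adj G v w ∧ not (does (v ≟ v) ∨ does (w ≟ v))) ≡ 0
    vanish w rewrite dec-true (v ≟ v) refl = cong 𝟙 (∧-zeroʳ (adj G v w))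

  module _ {n} (G : Graph n) (v : Fin n) where

    private
      H = isolate G v

      Leaving : Fin n → Fin n → ℕ
      Leaving u w = 𝟙 (adj G u w ∧ does (u ≟ v))

      Entering : Fin n → Fin n → ℕ
      Entering u w = 𝟙 (adj G u w ∧ does (w ≟ v))

      degree-isolate : ∀ u →
                       degree G u ≡ degree H u + ∑[ w < n ] Leaving u w + ∑[ w < n ] Entering u w
      degree-isolate u = begin
        degree G u
          ≡⟨ degree-∑ G u ⟩
        ∑[ w < n ] 𝟙 (adj G u w)
          ≡⟨ sum-cong-≗ (λ w → 𝟙-split (adj G u w) (does (u ≟ v)) (does (w ≟ v)) (no-loop w)) ⟩
        ∑[ w < n ] (𝟙 (adj H u w) + Leaving u w + Entering u w)
          ≡⟨ ∑-distrib-+₃ (𝟙 ∘ adj H u) (Leaving u) (Entering u) ⟩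
        ∑[ w < n ] 𝟙 (adj H u w) + ∑[ w < n ] Leaving u w + ∑[ w < n ] Entering u w
          ≡⟨ cong (λ d → d + ∑[ w < n ] Leaving u w + ∑[ w < n ] Entering u w) (degree-∑ H u) ⟨
        degree H u + ∑[ w < n ] Leaving u w + ∑[ w < n ] Entering u w
          ∎
        where
        open ≡-Reasoning
        no-loop : ∀ w → T (does (u ≟ v)) → T (does (w ≟ v)) → T (adj G u w) → ⊥
        no-loop w with u ≟ v | w ≟ v
        ... | yes u≡v | yes w≡v = λ _ _ uw → adj⇒≢ G uw (trans u≡v (sym w≡v))
        ... | yes _   | no _    = λ _ ()
        ... | no _    | _       = λ ()

      ∑-Leaving : ∑[ u < n ] ∑[ w < n ] Leaving u w ≡ degree G v
      ∑-Leaving = begin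
        ∑[ u < n ] ∑[ w < n ] Leaving u w ≡⟨ ∑-single (λ u → ∑[ w < n ] Leaving u w) v off-v ⟩
        ∑[ w < n ] Leaving v w            ≡⟨ sum-cong-≗ (λ w → 𝟙-∧-≟-refl (adj G v w) v) ⟩
        ∑[ w < n ] 𝟙 (adj G v w)          ≡⟨ degree-∑ G v ⟨
        degree G v                        ∎
        where
        open ≡-Reasoning
        off-v : ∀ u → u ≢ v → ∑[ w < n ] Leaving u w ≡ 0
        off-v u u≢v = trans (sum-cong-≗ λ w → 𝟙-∧-≟-≢ (adj G u w) u≢v) (sum-replicate-zero n)

      ∑-Entering : ∑[ u < n ] ∑[ w < n ] Entering u w ≡ degree G v
      ∑-Entering = begin
        ∑[ u < n ] ∑[ w < n ] Entering u w
          ≡⟨ sum-cong-≗ (λ u → ∑-single (Entering u) v λ w → 𝟙-∧-≟-≢ (adj G u w)) ⟩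
        ∑[ u < n ] Entering u v
          ≡⟨ sum-cong-≗ (λ u → trans (𝟙-∧-≟-refl (adj G u v) v) (cong 𝟙 (Graph.sym G u v))) ⟩
        ∑[ u < n ] 𝟙 (adj G v u)
          ≡⟨ degree-∑ G v ⟨
        degree G v
          ∎
        where open ≡-Reasoning

    edges-isolate : edges G ≡ edges H + degree G v
    edges-isolate = *-cancelˡ-≡ (edges G) (edges H + degree G v) 2 (begin
      2 * edges G
        ≡⟨ handshake G ⟨
      ∑[ u < n ] degree G u
        ≡⟨ sum-cong-≗ degree-isolate ⟩
      ∑[ u < n ] (degree H u + ∑[ w < n ] Leaving u w + ∑[ w < n ] Entering u w)
        ≡⟨ ∑-distrib-+₃ (degree H) (λ u → ∑[ w < n ] Leaving u w) (λ u → ∑[ w < n ] Entering u w) ⟩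
      ∑[ u < n ] degree H u + ∑[ u < n ] ∑[ w < n ] Leaving u w + ∑[ u < n ] ∑[ w < n ] Entering u w
        ≡⟨ cong₂ _+_ (cong₂ _+_ (handshake H) ∑-Leaving) ∑-Entering ⟩
      2 * edges H + degree G v + degree G v
        ≡⟨ solve 2 (λ e d → con 2 :* e :+ d :+ d := con 2 :* (e :+ d)) refl (edges H) (degree G v) ⟩
      2 * (edges H + degree G v)
        ∎)
      where
      open ≡-Reasoning
      open +-*-Solver

  record Pruning {n} (G : Graph n) (P : ℕ → Set) : Set where
    field
      graph      : Graph n
      cost       : Fin n → ℕ
      spanning   : SpanningSubgraph graph G
      edges-cost : edges G ≡ edges graph + ∑[ v < n ] cost v
      avoids     : ∀ v → ¬ P (degree graph v)
      cost-ok    : ∀ v → cost v ≡ 0 ⊎ (P (cost v) × cost v ≤ degree G v)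

  edges-split-isolate : ∀ {n e} (H : Graph n) (c : Fin n → ℕ) v → c v ≡ 0 →
                        e ≡ edges H + ∑[ u < n ] c u →
                        e ≡ edges (isolate H v) + ∑[ u < n ] updateAt c v (const (degree H v)) u
  edges-split-isolate {n} {e} H c v cv≡0 split = begin
    e                               ≡⟨ split ⟩
    edges H + ∑[ u < n ] c u        ≡⟨ cong (_+ ∑[ u < n ] c u) (edges-isolate H v) ⟩
    edges H′ + d + ∑[ u < n ] c u   ≡⟨ +-assoc (edges H′) d _ ⟩
    edges H′ + (d + ∑[ u < n ] c u) ≡⟨ cong (edges H′ +_) (+-comm d _) ⟩
    edges H′ + (∑[ u < n ] c u + d) ≡⟨ cong (edges H′ +_) ∑c′ ⟨
    edges H′ + ∑[ u < n ] c′ u      ∎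
    where
    open ≡-Reasoning
    d  = degree H v
    H′ = isolate H v
    c′ = updateAt c v (const d)
    ∑c′ : ∑[ u < n ] c′ u ≡ ∑[ u < n ] c u + d
    ∑c′ = begin
      ∑[ u < n ] c′ u       ≡⟨ +-identityʳ _ ⟨
      ∑[ u < n ] c′ u + 0   ≡⟨ cong (∑[ u < n ] c′ u +_) cv≡0 ⟨
      ∑[ u < n ] c′ u + c v ≡⟨ ∑-updateAt c v (const d) ⟩
      ∑[ u < n ] c u + d    ∎

  module _ {n} (G : Graph n) {P : ℕ → Set} (P? : Decidable P) (¬P0 : ¬ P 0) where

    private
      -- A charged vertex has already been isolated, so it can never be charged a second time.
      ChargedAt : Graph n → Fin n → ℕ → Set
      ChargedAt H v x = x ≡ 0 ⊎ (degree H v ≡ 0 × P x × x ≤ degree G v)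

      Charged : Graph n → (Fin n → ℕ) → Set
      Charged H c = ∀ v → ChargedAt H v (c v)

      charged-cost-ok : ∀ {H c} → Charged H c → ∀ v → c v ≡ 0 ⊎ (P (c v) × c v ≤ degree G v)
      charged-cost-ok charged v with charged v
      ... | inj₁ c≡0            = inj₁ c≡0
      ... | inj₂ (_ , Pc , c≤d) = inj₂ (Pc , c≤d)

      uncharged : ∀ {H c} v → P (degree H v) → Charged H c → c v ≡ 0
      uncharged v Pd charged with charged v
      ... | inj₁ cv≡0          = cv≡0
      ... | inj₂ (d≡0 , _ , _) = contradiction (subst P d≡0 Pd) ¬P0

      charge : ∀ {H c} v → SpanningSubgraph H G → P (degree H v) → Charged H c →
               Charged (isolate H v) (updateAt c v (const (degree H v)))
      charge {H} {c} v H⊆G Pd charged u = charge-at u (u ≟ v)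
        where
        H′ = isolate H v
        c′ = updateAt c v (const (degree H v))

        stays-charged : ∀ {u} → ChargedAt H u (c u) → ChargedAt H′ u (c u)
        stays-charged     (inj₁ cu≡0)              = inj₁ cu≡0
        stays-charged {u} (inj₂ (du≡0 , Pc , c≤d)) = inj₂ (du′≡0 , Pc , c≤d)
          where
          du′≡0 : degree H′ u ≡ 0
          du′≡0 = n≤0⇒n≡0 (subst (degree H′ u ≤_) du≡0 (degree-mono {H = H′} {H} (isolate-⊆ H v) u))

        charge-at : ∀ u → Dec (u ≡ v) → ChargedAt H′ u (c′ u)
        charge-at u (yes refl) =
          subst (ChargedAt H′ v) (sym (updateAt-updates v {const (degree H v)} c))
            (inj₂ (degree-isolate-self H v , Pd , degree-mono {H = H} {G} H⊆G v))
        charge-at u (no u≢v) =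
          subst (ChargedAt H′ u) (sym (updateAt-minimal u v c u≢v)) (stays-charged (charged u))

      prune-from : (H : Graph n) (c : Fin n → ℕ) → Acc _<_ (edges H) → SpanningSubgraph H G →
                   edges G ≡ edges H + ∑[ v < n ] c v → Charged H c → Pruning G P
      prune-from H c (acc smaller) H⊆G split charged with any? (P? ∘ degree H)
      ... | no none = record
        { graph = H ; cost = c ; spanning = H⊆G ; edges-cost = split
        ; avoids = λ v Pv → none (v , Pv) ; cost-ok = charged-cost-ok {H} {c} charged }
      ... | yes (v , Pd) =
        prune-from (isolate H v) (updateAt c v (const (degree H v))) (smaller fewer)
          (λ u w → H⊆G u w ∘ isolate-⊆ H v u w)
          (edges-split-isolate H c v (uncharged {H} {c} v Pd charged) split)
          (charge {H} {c} v H⊆G Pd charged)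
        where
        fewer : edges (isolate H v) < edges H
        fewer = subst (edges (isolate H v) <_) (sym (edges-isolate H v))
                      (m<m+n (edges (isolate H v)) (n≢0⇒n>0 λ d≡0 → ¬P0 (subst P d≡0 Pd)))

    prune : Pruning G P
    prune = prune-from G (const 0) (<-wellFounded (edges G)) (λ _ _ → id) split₀ (λ _ → inj₁ refl)
      where
      split₀ : edges G ≡ edges G + ∑[ v < n ] 0
      split₀ = sym (trans (cong (edges G +_) (sum-replicate-zero n)) (+-identityʳ (edges G)))

  partialSum : (ℕ → ℕ) → ℕ → ℕ
  partialSum x zero    = 0
  partialSum x (suc m) = partialSum x m + x m

  partialSum-∑ : ∀ {n} (f : ℕ → Fin n → ℕ) m →
                 partialSum (λ i → ∑[ v < n ] f i v) m ≡ ∑[ v < n ] partialSum (λ i → f i v) m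
  partialSum-∑ {n} f zero    = sym (sum-replicate-zero n)
  partialSum-∑ {n} f (suc m) = trans (cong (_+ sum (f m)) (partialSum-∑ f m))
                                     (sym (∑-distrib-+ (λ v → partialSum (λ i → f i v) m) (f m)))

  ∃-≤-average : ∀ m (x : ℕ → ℕ) → ∃ λ i → i < suc m × suc m * x i ≤ partialSum x (suc m)
  ∃-≤-average zero    x = 0 , s≤s z≤n , ≤-reflexive (+-identityʳ (x 0))
  ∃-≤-average (suc m) x with ∃-≤-average m x
  ... | i , i<1+m , average≤ with x i ≤? x (suc m)
  ...   | yes xi≤ = i , m<n⇒m<1+n i<1+m , (begin
    x i + suc m * x i                ≤⟨ +-mono-≤ xi≤ average≤ ⟩
    x (suc m) + partialSum x (suc m) ≡⟨ +-comm (x (suc m)) _ ⟩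
    partialSum x (suc (suc m))       ∎)
    where open ≤-Reasoning
  ...   | no xi≰ = suc m , ≤-refl , (begin
    x (suc m) + suc m * x (suc m)    ≤⟨ +-monoʳ-≤ (x (suc m)) (*-monoʳ-≤ (suc m) (<⇒≤ (≰⇒> xi≰))) ⟩
    x (suc m) + suc m * x i          ≤⟨ +-monoʳ-≤ (x (suc m)) average≤ ⟩
    x (suc m) + partialSum x (suc m) ≡⟨ +-comm (x (suc m)) _ ⟩
    partialSum x (suc (suc m))       ∎)
    where open ≤-Reasoning

open Counting

open import Data.Rational using (ℚ; _/_; _*_; _-_; _≤_; _<_; 0ℚ; 1ℚ; ½)
open import Data.Rational
  using (mkℚ; _+_; -_; *≤*; Positive; NonNegative; positive; nonNegative; toℚᵘ)
open import Data.Rational.Properties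
open import Data.Rational.Solver using (module +-*-Solver)
import Data.Rational.Unnormalised as ℚᵘ
import Data.Rational.Unnormalised.Properties as ℚᵘ
open import Data.Nat using (zero)
open import Data.Integer as ℤ using (+_; +[1+_])
import Data.Integer.Properties as ℤ
open import Data.Nat.Coprimality using (1-coprimeTo)
import Data.Nat.Coprimality as Coprime
open import Data.Nat.DivMod using (m≡m%n+[m/n]*n; m%n<n; m/n*n≤m)
import Data.Nat.Solver as ℕ

ℕ→ℚ≡mkℚ : ∀ a → ℕ→ℚ a ≡ mkℚ (+ a) 0 (Coprime.sym (1-coprimeTo a))
ℕ→ℚ≡mkℚ a = normalize-coprime _

ℕ→ℚ-+ : ∀ a b → ℕ→ℚ (a ℕ.+ b) ≡ ℕ→ℚ a + ℕ→ℚ b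
ℕ→ℚ-+ a b = trans (/-cong numerators refl) (sym (cong₂ _+_ (ℕ→ℚ≡mkℚ a) (ℕ→ℚ≡mkℚ b)))
  where
  numerators : + (a ℕ.+ b) ≡ + a ℤ.* + 1 ℤ.+ + b ℤ.* + 1
  numerators = trans (ℤ.pos-+ a b) (sym (cong₂ ℤ._+_ (ℤ.*-identityʳ (+ a)) (ℤ.*-identityʳ (+ b))))

ℕ→ℚ-* : ∀ a b → ℕ→ℚ (a ℕ.* b) ≡ ℕ→ℚ a * ℕ→ℚ b
ℕ→ℚ-* a b = trans (/-cong (ℤ.pos-* a b) refl) (sym (cong₂ _*_ (ℕ→ℚ≡mkℚ a) (ℕ→ℚ≡mkℚ b)))

ℕ→ℚ-mono-≤ : ∀ {a b} → a ≤ℕ b → ℕ→ℚ a ≤ ℕ→ℚ b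
ℕ→ℚ-mono-≤ {a} {b} a≤b rewrite ℕ→ℚ≡mkℚ a | ℕ→ℚ≡mkℚ b =
  *≤* (subst₂ ℤ._≤_ (sym (ℤ.*-identityʳ (+ a))) (sym (ℤ.*-identityʳ (+ b))) (ℤ.+≤+ a≤b))

ℕ→ℚ-cancel-≤ : ∀ {a b} → ℕ→ℚ a ≤ ℕ→ℚ b → a ≤ℕ b
ℕ→ℚ-cancel-≤ {a} {b} a≤b rewrite ℕ→ℚ≡mkℚ a | ℕ→ℚ≡mkℚ b with a≤b
... | *≤* a≤b = ℤ.drop‿+≤+ (subst₂ ℤ._≤_ (ℤ.*-identityʳ (+ a)) (ℤ.*-identityʳ (+ b)) a≤b)

ℕ→ℚ-nonNeg : ∀ a → NonNegative (ℕ→ℚ a)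
ℕ→ℚ-nonNeg a = nonNegative (ℕ→ℚ-mono-≤ {0} {a} ℕ.z≤n)

ℕ→ℚ-pos : ∀ a → .{{NonZero a}} → Positive (ℕ→ℚ a)
ℕ→ℚ-pos (suc a) rewrite ℕ→ℚ≡mkℚ (suc a) = _

[+m/n]*n≡m : ∀ m n .{{_ : NonZero n}} → (+ m / n) * ℕ→ℚ n ≡ ℕ→ℚ m
[+m/n]*n≡m m n@(suc n-1) = toℚᵘ-injective (begin
  toℚᵘ ((+ m / n) * ℕ→ℚ n)                ≈⟨ toℚᵘ-homo-* (+ m / n) (ℕ→ℚ n) ⟩
  toℚᵘ (+ m / n) ℚᵘ.* toℚᵘ (ℕ→ℚ n)        ≈⟨ ℚᵘ.*-cong (toℚᵘ-fromℚᵘ (ℚᵘ.mkℚᵘ (+ m) n-1))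
                                                          (ℚᵘ.≃-reflexive (cong toℚᵘ (ℕ→ℚ≡mkℚ n))) ⟩
  ℚᵘ.mkℚᵘ (+ m) n-1 ℚᵘ.* ℚᵘ.mkℚᵘ (+ n) 0 ≈⟨ ℚᵘ.*≡* cross ⟩
  ℚᵘ.mkℚᵘ (+ m) 0                          ≡⟨ cong toℚᵘ (ℕ→ℚ≡mkℚ m) ⟨
  toℚᵘ (ℕ→ℚ m)                             ∎)
  where
  open ℚᵘ.≃-Reasoning
  cross : (+ m ℤ.* + n) ℤ.* + 1 ≡ + m ℤ.* + (n ℕ.* 1)
  cross = trans (ℤ.*-identityʳ _) (cong (λ d → + m ℤ.* + d) (sym (ℕ.*-identityʳ n)))

m≤[1+m/n]*n : ∀ m n .{{_ : NonZero n}} → m ≤ℕ suc (m ℕ./ n) ℕ.* n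
m≤[1+m/n]*n m n = begin
  m                         ≡⟨ m≡m%n+[m/n]*n m n ⟩
  m ℕ.% n ℕ.+ m ℕ./ n ℕ.* n ≤⟨ ℕ.+-monoˡ-≤ (m ℕ./ n ℕ.* n) (ℕ.<⇒≤ (m%n<n m n)) ⟩
  suc (m ℕ./ n) ℕ.* n       ∎
  where open ℕ.≤-Reasoning

[1+m/n]*n≤m+n : ∀ m n .{{_ : NonZero n}} → suc (m ℕ./ n) ℕ.* n ≤ℕ m ℕ.+ n
[1+m/n]*n≤m+n m n = ℕ.≤-trans (ℕ.+-monoʳ-≤ n (m/n*n≤m m n)) (ℕ.≤-reflexive (ℕ.+-comm n m))

∃-multiple-between : ∀ c η .{{_ : Positive η}} →
                     ∃ λ m → ℕ→ℚ c ≤ ℕ→ℚ (suc m) * η × ℕ→ℚ (suc m) * η ≤ ℕ→ℚ c + η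
∃-multiple-between c η@(mkℚ +[1+ p-1 ] q-1 _) = m , lower , upper
  where
  p = suc p-1
  q = suc q-1
  m = (q ℕ.* c) ℕ./ p

  instance
    q>0 : Positive (ℕ→ℚ q)
    q>0 = ℕ→ℚ-pos q

  qη≡p : ℕ→ℚ q * η ≡ ℕ→ℚ p
  qη≡p = trans (*-comm (ℕ→ℚ q) η) (trans (cong (_* ℕ→ℚ q) (sym (↥p/↧p≡p η))) ([+m/n]*n≡m p q))

  q[aη]≡ap : ∀ a → ℕ→ℚ q * (ℕ→ℚ a * η) ≡ ℕ→ℚ (a ℕ.* p)
  q[aη]≡ap a = begin
    ℕ→ℚ q * (ℕ→ℚ a * η) ≡⟨ solve 3 (λ q a η → q :* (a :* η) := a :* (q :* η)) refl
                                   (ℕ→ℚ q) (ℕ→ℚ a) η ⟩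
    ℕ→ℚ a * (ℕ→ℚ q * η) ≡⟨ cong (ℕ→ℚ a *_) qη≡p ⟩
    ℕ→ℚ a * ℕ→ℚ p       ≡⟨ ℕ→ℚ-* a p ⟨
    ℕ→ℚ (a ℕ.* p)       ∎
    where
    open ≡-Reasoning
    open +-*-Solver

  lower : ℕ→ℚ c ≤ ℕ→ℚ (suc m) * η
  lower = *-cancelˡ-≤-pos (ℕ→ℚ q) (begin
    ℕ→ℚ q * ℕ→ℚ c              ≡⟨ ℕ→ℚ-* q c ⟨
    ℕ→ℚ (q ℕ.* c)              ≤⟨ ℕ→ℚ-mono-≤ (m≤[1+m/n]*n (q ℕ.* c) p) ⟩
    ℕ→ℚ (suc m ℕ.* p)          ≡⟨ q[aη]≡ap (suc m) ⟨
    ℕ→ℚ q * (ℕ→ℚ (suc m) * η) ∎)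
    where open ≤-Reasoning

  upper : ℕ→ℚ (suc m) * η ≤ ℕ→ℚ c + η
  upper = *-cancelˡ-≤-pos (ℕ→ℚ q) (begin
    ℕ→ℚ q * (ℕ→ℚ (suc m) * η) ≡⟨ q[aη]≡ap (suc m) ⟩
    ℕ→ℚ (suc m ℕ.* p)         ≤⟨ ℕ→ℚ-mono-≤ ([1+m/n]*n≤m+n (q ℕ.* c) p) ⟩
    ℕ→ℚ (q ℕ.* c ℕ.+ p)       ≡⟨ ℕ→ℚ-+ (q ℕ.* c) p ⟩
    ℕ→ℚ (q ℕ.* c) + ℕ→ℚ p     ≡⟨ cong₂ _+_ (ℕ→ℚ-* q c) (sym qη≡p) ⟩
    ℕ→ℚ q * ℕ→ℚ c + ℕ→ℚ q * η ≡⟨ *-distribˡ-+ (ℕ→ℚ q) (ℕ→ℚ c) η ⟨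
    ℕ→ℚ q * (ℕ→ℚ c + η)       ∎)
    where open ≤-Reasoning

m*g≤c*e⇒g≤η*e : ∀ {c m g e η} .{{_ : NonZero c}} → 0ℚ ≤ η → ℕ→ℚ c ≤ ℕ→ℚ m * η →
                m ℕ.* g ≤ℕ c ℕ.* e → ℕ→ℚ g ≤ η * ℕ→ℚ e
m*g≤c*e⇒g≤η*e {c} {m} {g} {e} {η} 0≤η c≤mη mg≤ce = *-cancelˡ-≤-pos (ℕ→ℚ c) {{ℕ→ℚ-pos c}} (begin
  ℕ→ℚ c * ℕ→ℚ g       ≤⟨ *-monoʳ-≤-nonNeg (ℕ→ℚ g) {{ℕ→ℚ-nonNeg g}} c≤mη ⟩
  ℕ→ℚ m * η * ℕ→ℚ g   ≡⟨ solve 3 (λ m η g → m :* η :* g := η :* (m :* g)) refl (ℕ→ℚ m) η (ℕ→ℚ g) ⟩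
  η * (ℕ→ℚ m * ℕ→ℚ g) ≡⟨ cong (η *_) (ℕ→ℚ-* m g) ⟨
  η * ℕ→ℚ (m ℕ.* g)   ≤⟨ *-monoˡ-≤-nonNeg η {{nonNegative 0≤η}} (ℕ→ℚ-mono-≤ mg≤ce) ⟩
  η * ℕ→ℚ (c ℕ.* e)   ≡⟨ cong (η *_) (ℕ→ℚ-* c e) ⟩
  η * (ℕ→ℚ c * ℕ→ℚ e) ≡⟨ solve 3 (λ η c e → η :* (c :* e) := c :* (η :* e)) refl η (ℕ→ℚ c) (ℕ→ℚ e) ⟩
  ℕ→ℚ c * (η * ℕ→ℚ e) ∎)
  where
  open ≤-Reasoning
  open +-*-Solver

e≡e′+c⇒e-x≤e′ : ∀ {e e′ c} x → e ≡ e′ ℕ.+ c → ℕ→ℚ c ≤ x → ℕ→ℚ e - x ≤ ℕ→ℚ e′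
e≡e′+c⇒e-x≤e′ {e′ = e′} {c} x refl c≤x = begin
  ℕ→ℚ (e′ ℕ.+ c) - x   ≡⟨ cong (_- x) (ℕ→ℚ-+ e′ c) ⟩
  ℕ→ℚ e′ + ℕ→ℚ c - x   ≤⟨ +-monoˡ-≤ (- x) (+-monoʳ-≤ (ℕ→ℚ e′) c≤x) ⟩
  ℕ→ℚ e′ + x - x       ≡⟨ solve 2 (λ e x → e :+ x :- x := e) refl (ℕ→ℚ e′) x ⟩
  ℕ→ℚ e′               ∎
  where
  open ≤-Reasoning
  open +-*-Solver

InWindow : (ℕ → ℚ) → ℕ → ℕ → Set
InWindow ω i y = ω i ≤ ℕ→ℚ y × ℕ→ℚ y < ω (suc i)

InWindow? : ∀ ω i → Decidable (InWindow ω i)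
InWindow? ω i y = (ω i ≤? ℕ→ℚ y) ×-dec (ℕ→ℚ y <? ω (suc i))

windowed-sum-≤ : ∀ {ω : ℕ → ℚ} → (∀ i → 0ℚ ≤ ω i) → (∀ i → ω i + ω i ≤ ω (suc i)) →
                 ∀ (x : ℕ → ℕ) d → (∀ i → x i ≡ 0 ⊎ (InWindow ω i (x i) × x i ≤ℕ d)) →
                 ∀ m → partialSum x m ≤ℕ 3 ℕ.* d
windowed-sum-≤ {ω} ω-nonNeg ω-doubling x d x-ok m = proj₁ (bounds m)
  where
  -- The ℚ invariant bounds the earlier terms by twice any term that lands in window m.
  bounds : ∀ m → partialSum x m ≤ℕ 3 ℕ.* d × ℕ→ℚ (partialSum x m) ≤ ω m + ω m
  bounds zero    = ℕ.z≤n , +-mono-≤ (ω-nonNeg 0) (ω-nonNeg 0)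
  bounds (suc m) = step (x-ok m) (bounds m)
    where
    S = partialSum x m
    step : x m ≡ 0 ⊎ (InWindow ω m (x m) × x m ≤ℕ d) →
           S ≤ℕ 3 ℕ.* d × ℕ→ℚ S ≤ ω m + ω m →
           S ℕ.+ x m ≤ℕ 3 ℕ.* d × ℕ→ℚ (S ℕ.+ x m) ≤ ω (suc m) + ω (suc m)
    step (inj₁ xm≡0) (S≤3d , S≤2ω) rewrite xm≡0 | ℕ.+-identityʳ S = S≤3d , (begin
      ℕ→ℚ S                 ≤⟨ S≤2ω ⟩
      ω m + ω m             ≤⟨ ω-doubling m ⟩
      ω (suc m)             ≡⟨ +-identityʳ (ω (suc m)) ⟨
      ω (suc m) + 0ℚ        ≤⟨ +-monoʳ-≤ (ω (suc m)) (ω-nonNeg (suc m)) ⟩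
      ω (suc m) + ω (suc m) ∎)
      where open ≤-Reasoning
    step (inj₂ ((ω≤x , x<ω) , xm≤d)) (_ , S≤2ω) = S+x≤3d , (begin
      ℕ→ℚ (S ℕ.+ x m)       ≡⟨ ℕ→ℚ-+ S (x m) ⟩
      ℕ→ℚ S + ℕ→ℚ (x m)     ≤⟨ +-mono-≤ S≤2ω (<⇒≤ x<ω) ⟩
      ω m + ω m + ω (suc m) ≤⟨ +-monoˡ-≤ (ω (suc m)) (ω-doubling m) ⟩
      ω (suc m) + ω (suc m) ∎)
      where
      open ≤-Reasoning
      S≤2x : S ≤ℕ x m ℕ.+ x m
      S≤2x = ℕ→ℚ-cancel-≤ (begin
        ℕ→ℚ S                 ≤⟨ S≤2ω ⟩
        ω m + ω m             ≤⟨ +-mono-≤ ω≤x ω≤x ⟩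
        ℕ→ℚ (x m) + ℕ→ℚ (x m) ≡⟨ ℕ→ℚ-+ (x m) (x m) ⟨
        ℕ→ℚ (x m ℕ.+ x m)     ∎)
      S+x≤3d : S ℕ.+ x m ≤ℕ 3 ℕ.* d
      S+x≤3d = ℕ.≤-trans (ℕ.+-monoˡ-≤ (x m) S≤2x)
        (ℕ.≤-trans (ℕ.≤-reflexive (solve 1 (λ x → x :+ x :+ x := con 3 :* x) refl (x m)))
                   (ℕ.*-monoʳ-≤ 3 xm≤d))
        where open ℕ.+-*-Solver

record DoublingWindows (ω : ℕ → ℚ) : Set where
  field
    nonNeg   : ∀ i → 0ℚ ≤ ω i
    doubling : ∀ i → ω i + ω i ≤ ω (suc i)
    0∉window : ∀ i → ¬ InWindow ω i 0

a≤η½b⇒a+a≤b : ∀ {η a b} → η ≤ 1ℚ → 0ℚ ≤ b → a ≤ η * ½ * b → a + a ≤ b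
a≤η½b⇒a+a≤b {η} {a} {b} η≤1 0≤b a≤η½b = begin
  a + a                 ≤⟨ +-mono-≤ a≤η½b a≤η½b ⟩
  η * ½ * b + η * ½ * b ≡⟨ solve 2 (λ η b → η :* con ½ :* b :+ η :* con ½ :* b := η :* b) refl η b ⟩
  η * b                 ≤⟨ *-monoʳ-≤-nonNeg b {{nonNegative 0≤b}} η≤1 ⟩
  1ℚ * b                ≡⟨ *-identityˡ b ⟩
  b                     ∎
  where
  open ≤-Reasoning
  open +-*-Solver

a*k≤0⇒b*k≤0 : ∀ {a b k} → 0ℚ < a → 0ℚ ≤ b → a * k ≤ 0ℚ → b * k ≤ 0ℚ
a*k≤0⇒b*k≤0 {a} {b} {k} 0<a 0≤b ak≤0 = begin
  b * k  ≤⟨ *-monoˡ-≤-nonNeg b {{nonNegative 0≤b}} k≤0 ⟩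
  b * 0ℚ ≡⟨ *-zeroʳ b ⟩
  0ℚ     ∎
  where
  open ≤-Reasoning
  k≤0 : k ≤ 0ℚ
  k≤0 = *-cancelˡ-≤-pos a {{positive 0<a}} (≤-trans ak≤0 (≤-reflexive (sym (*-zeroʳ a))))

ratio-windows : ∀ {η} (Ω : ℕ → ℚ) k → η ≤ 1ℚ → 0ℚ ≤ k → (∀ i → 1 ≤ℕ i → 0ℚ < Ω i) →
                (∀ j → 1 ≤ℕ j → Ω j ≤ (η * ½) * Ω (suc j)) → DoublingWindows (λ i → Ω (suc i) * k)
ratio-windows Ω k η≤1 0≤k 0<Ω Ω-ratio = record
  { nonNeg = nonNeg ; doubling = doubling ; 0∉window = 0∉window }
  where
  instance
    k≥0 : NonNegative k
    k≥0 = nonNegative 0≤k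

  0<Ω₊ : ∀ i → 0ℚ < Ω (suc i)
  0<Ω₊ i = 0<Ω (suc i) (ℕ.s≤s ℕ.z≤n)

  nonNeg : ∀ i → 0ℚ ≤ Ω (suc i) * k
  nonNeg i = ≤-trans (≤-reflexive (sym (*-zeroˡ k))) (*-monoʳ-≤-nonNeg k (<⇒≤ (0<Ω₊ i)))

  doubling : ∀ i → Ω (suc i) * k + Ω (suc i) * k ≤ Ω (suc (suc i)) * k
  doubling i = ≤-trans (≤-reflexive (sym (*-distribʳ-+ k (Ω (suc i)) (Ω (suc i)))))
    (*-monoʳ-≤-nonNeg k (a≤η½b⇒a+a≤b η≤1 (<⇒≤ (0<Ω₊ (suc i))) (Ω-ratio (suc i) (ℕ.s≤s ℕ.z≤n))))

  0∉window : ∀ i → ¬ InWindow (λ i → Ω (suc i) * k) i 0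
  0∉window i (Ωk≤0 , 0<Ω₊k) =
    <-irrefl refl (<-≤-trans 0<Ω₊k (a*k≤0⇒b*k≤0 (0<Ω₊ i) (<⇒≤ (0<Ω₊ (suc i))) Ωk≤0))

module _ {n} (G : Graph n) {ω : ℕ → ℚ} (W : DoublingWindows ω) where
  open DoublingWindows W

  pruned : ∀ i → Pruning G (InWindow ω i)
  pruned i = prune G (InWindow? ω i) (0∉window i)

  pruning-cost : ℕ → ℕ
  pruning-cost i = ∑[ v < n ] Pruning.cost (pruned i) v

  total-cost-≤ : ∀ m → partialSum pruning-cost m ≤ℕ 3 ℕ.* (2 ℕ.* edges G)
  total-cost-≤ m = begin
    partialSum pruning-cost m                                 ≡⟨ partialSum-∑ (Pruning.cost ∘ pruned) m ⟩
    ∑[ v < n ] partialSum (λ i → Pruning.cost (pruned i) v) m ≤⟨ ∑-mono-≤ per-vertex ⟩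
    ∑[ v < n ] (3 ℕ.* degree G v)                             ≡⟨ *-distribˡ-sum 3 (degree G) ⟨
    3 ℕ.* ∑[ v < n ] degree G v                               ≡⟨ cong (3 ℕ.*_) (handshake G) ⟩
    3 ℕ.* (2 ℕ.* edges G)                                     ∎
    where
    open ℕ.≤-Reasoning
    per-vertex : ∀ v → partialSum (λ i → Pruning.cost (pruned i) v) m ≤ℕ 3 ℕ.* degree G v
    per-vertex v =
      windowed-sum-≤ nonNeg doubling _ (degree G v) (λ i → Pruning.cost-ok (pruned i) v) m

  cheap-window : ∀ η → 0ℚ < η → η ≤ 1ℚ →
                 ∃ λ i → ℕ→ℚ (suc i) * η ≤ ℕ→ℚ 4 × ℕ→ℚ (pruning-cost i) ≤ η * ℕ→ℚ (2 ℕ.* edges G)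
  cheap-window η 0<η η≤1 =
    -- Not `with`: abstracting over the goal would normalise ℕ→ℚ literals, i.e. run gcd by
    -- well-founded recursion, which exhausts memory.
    let (m , 3≤Mη , Mη≤3+η) = ∃-multiple-between 3 η {{positive 0<η}}
        (i , i<M , average≤) = ∃-≤-average m pruning-cost
    in i , index-bound i<M Mη≤3+η ,
       m*g≤c*e⇒g≤η*e {3} {suc m} {pruning-cost i} {2 ℕ.* edges G} (<⇒≤ 0<η) 3≤Mη
         (ℕ.≤-trans average≤ (total-cost-≤ (suc m)))
    where
    index-bound : ∀ {i m} → suc i ≤ℕ suc m → ℕ→ℚ (suc m) * η ≤ ℕ→ℚ 3 + η → ℕ→ℚ (suc i) * η ≤ ℕ→ℚ 4
    index-bound {i} {m} i<M Mη≤3+η = begin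
      ℕ→ℚ (suc i) * η ≤⟨ *-monoʳ-≤-nonNeg η {{nonNegative (<⇒≤ 0<η)}} (ℕ→ℚ-mono-≤ i<M) ⟩
      ℕ→ℚ (suc m) * η ≤⟨ Mη≤3+η ⟩
      ℕ→ℚ 3 + η       ≤⟨ +-monoʳ-≤ (ℕ→ℚ 3) η≤1 ⟩
      ℕ→ℚ 3 + ℕ→ℚ 1   ≡⟨ ℕ→ℚ-+ 3 1 ⟨
      ℕ→ℚ 4           ∎
      where open ≤-Reasoning

lemma3p1 : (η : ℚ) → 0ℚ < η → η < 1ℚ →
    (Ω : ℕ → ℚ) → (∀ i → 1 ≤ℕ i → 0ℚ < Ω i) →
    (∀ j → 1 ≤ℕ j → Ω j ≤ (η * ½) * Ω (suc j)) →
    (n : ℕ) → .{{_ : NonZero n}} → (G : Graph n) →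
    let k = + (2 Data.Nat.* edges G) / n in
    Σ ℕ λ i* → 1 ≤ℕ i* × ℕ→ℚ i* * η ≤ ℕ→ℚ 4 ×
      Σ (Graph n) λ G' → SpanningSubgraph G' G ×
        ℕ→ℚ (edges G) - η * k * ℕ→ℚ n ≤ ℕ→ℚ (edges G') ×
        (∀ (v : Fin n) → ¬ (Ω i* * k ≤ ℕ→ℚ (degree G' v) × ℕ→ℚ (degree G' v) < Ω (suc i*) * k))
lemma3p1 η 0<η η<1 Ω 0<Ω Ω-ratio n G =
  let (i , i*η≤4 , cost≤η2e) = cheap-window G W η 0<η (<⇒≤ η<1)
      open Pruning (pruned G W i)
  in suc i , ℕ.s≤s ℕ.z≤n , i*η≤4 , graph , spanning ,
     e≡e′+c⇒e-x≤e′ {e′ = edges graph} {pruning-cost G W i} (η * k * ℕ→ℚ n) edges-cost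
       (subst (ℕ→ℚ (pruning-cost G W i) ≤_) (sym ηkn≡η2e) cost≤η2e) , avoids
  where
  k = + (2 ℕ.* edges G) / n

  W : DoublingWindows (λ i → Ω (suc i) * k)
  W = ratio-windows Ω k (<⇒≤ η<1) (nonNegative⁻¹ k {{normalize-nonNeg (2 ℕ.* edges G) n}})
                    0<Ω Ω-ratio

  ηkn≡η2e : η * k * ℕ→ℚ n ≡ η * ℕ→ℚ (2 ℕ.* edges G)
  ηkn≡η2e = trans (*-assoc η k (ℕ→ℚ n)) (cong (η *_) ([+m/n]*n≡m (2 ℕ.* edges G) n))
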